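{- Let $G=(V,A)$ be a flow graph with start vertex $s$, let $T$ be a rooted tree with the parent property, and let $G'$ be the derived graph of $G$ with respect to $T$. If $P$ is a simple path in $G$ from $s$ to $v$, then there is a simple path in $G'$ from $s$ to $v$ containing only vertices on $P$.
   Context: A flow graph is a finite directed graph $G=(V,A)$ with start vertex $s$ such that every vertex is reachable from $s$; there are no arcs entering $s$. For a rooted tree $T$ with vertex set contained in $V$, $t(v)$ denotes the parent of $v$; ancestors and descendants include the vertex itself. $T$ has the parent property if for every arc $(v,w)\in A$, $t(w)$ is an ancestor of $v$ in $T$. For an arc $(v,w)\in A$, its derived arc is null if $w$ is an ancestor of $v$ in $T$, and otherwise is $(v',w)$, where $v'=v$ if $v=t(w)$, and otherwise $v'$ is the sibling of $w$ in $T$ that is an ancestor of $v$. The derived graph $G'$ has vertex set $V$ and arc set consisting of all non-null derived arcs of arcs in $A$. -}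

module Defs where

open import Data.Nat using (ℕ)
open import Data.Fin using (Fin)
open import Data.Maybe using (Maybe; just; nothing)
open import Data.List using (List; []; _∷_)
open import Data.List.Membership.Propositional using (_∈_)
open import Data.Product using (_×_; _,_; ∃; ∃-syntax)
open import Data.Sum using (_⊎_)
open import Relation.Nullary using (¬_)
open import Relation.Binary.PropositionalEquality using (_≡_; _≢_)

Arcs : ℕ → Set
Arcs n = List (Fin n × Fin n)

data Walk {n : ℕ} (E : Fin n → Fin n → Set) : Fin n → Fin n → List (Fin n) → Set where
  here  : ∀ {x} → Walk E x x (x ∷ [])
  step  : ∀ {x y z vs} → E x y → Walk E y z vs → Walk E x z (x ∷ vs)

Arc : {n : ℕ} → Arcs n → Fin n → Fin n → Set
Arc A v w = (v , w) ∈ A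

record IsFlowGraph {n : ℕ} (A : Arcs n) (s : Fin n) : Set where
  field
    no-entry  : ∀ v → ¬ ((v , s) ∈ A)
    reachable : ∀ v → ∃[ vs ] Walk (Arc A) s v vs

-- Ancestor relation w.r.t. a parent function: Anc par u v  means u is an
-- ancestor of v (reflexive: every vertex is its own ancestor).
data Anc {n : ℕ} (par : Fin n → Maybe (Fin n)) : Fin n → Fin n → Set where
  refl-anc : ∀ {v} → Anc par v v
  up-anc   : ∀ {u v p} → par v ≡ just p → Anc par u p → Anc par u v

-- A rooted tree whose vertex set (inT) is contained in Fin n.
-- parent v = just p  means t(v) = p;  the root and non-tree vertices have no parent.
record RootedTree (n : ℕ) : Set₁ where
  field
    inT       : Fin n → Set
    root      : Fin n
    parent    : Fin n → Maybe (Fin n)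
    root-in   : inT root
    root-par  : parent root ≡ nothing
    par-in    : ∀ v → inT v → v ≢ root → ∃[ p ] (parent v ≡ just p × inT p)
    par-out   : ∀ v → ¬ inT v → parent v ≡ nothing
    to-root   : ∀ v → inT v → Anc parent root v

ParentProperty : {n : ℕ} → Arcs n → RootedTree n → Set
ParentProperty A T = ∀ v w → (v , w) ∈ A →
  ∃[ p ] (RootedTree.parent T w ≡ just p × Anc (RootedTree.parent T) p v)

-- Derived arc (v' , w) of the arc (v , w): defined when w is not an ancestor
-- of v; v' = v if v = t(w), otherwise v' is the sibling of w that is an
-- ancestor of v.
DerivedArcOf : {n : ℕ} → RootedTree n → Fin n → Fin n → Fin n → Set
DerivedArcOf T v w v' =
  ¬ Anc par w v ×
  ((par w ≡ just v × v' ≡ v)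
   ⊎ (par w ≢ just v × ∃[ p ] (par w ≡ just p × par v' ≡ just p × v' ≢ w × Anc par v' v)))
  where par = RootedTree.parent T

DerivedArc : {n : ℕ} → Arcs n → RootedTree n → Fin n → Fin n → Set
DerivedArc A T v' w = ∃[ v ] ((v , w) ∈ A × DerivedArcOf T v w v')

module Submission where

-- Write "a ↝ M" when G' has a walk from s to a using only vertices of the
-- list M.  The proof follows P arc by arc, maintaining the invariant that
-- every tree ancestor of the current vertex y satisfies a ↝ P.  At s this
-- holds because s is the root of T (the root is reachable from s, and no arc
-- enters the root by the parent property).  Across an arc (y , z) of P the
-- parent property makes every proper ancestor of z an ancestor of y, so only
-- z itself needs an argument: climbing from t(z) to y shows that either z is
-- an ancestor of y, or the derived arc of (y , z) is (v' , z) with v' an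
-- ancestor of y; in both cases z ↝ P follows.  At the end, v ↝ P, and the
-- resulting walk in G' is shortened to a simple one.

open import Defs
open import Data.Nat using (ℕ)
open import Data.Fin using (Fin; _≟_)
open import Data.Maybe using (Maybe; just; nothing)
open import Data.List using (List; []; _∷_; _++_)
open import Data.List.Membership.Propositional using (_∈_)
open import Data.List.Relation.Binary.Subset.Propositional using (_⊆_)
open import Data.List.Relation.Unary.Any using (here; there; any?)
open import Data.List.Relation.Unary.All as All using (All; []; _∷_)
open import Data.List.Relation.Unary.All.Properties using (¬Any⇒All¬; ++⁺)
open import Data.List.Relation.Unary.Unique.Propositional using (Unique)
open import Data.List.Relation.Unary.AllPairs using ([]; _∷_)
open import Data.Product using (_×_; ∃-syntax; _,_; proj₂)
open import Data.Sum using (_⊎_; inj₁; inj₂)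
open import Data.Empty using (⊥-elim)
open import Relation.Nullary using (¬_; yes; no)
open import Relation.Binary.PropositionalEquality using (_≡_; refl; sym; trans; subst; _≢_)

nothing≢just : ∀ {B : Set} {x : B} → nothing ≢ just x
nothing≢just ()

module WalkFacts {n : ℕ} {E : Fin n → Fin n → Set} where

  walk-head∈ : ∀ {x z vs} → Walk E x z vs → x ∈ vs
  walk-head∈ here       = here refl
  walk-head∈ (step _ _) = here refl

  walk-snoc : ∀ {x y z vs} → Walk E x y vs → E y z → Walk E x z (vs ++ (z ∷ []))
  walk-snoc here        e = step e here
  walk-snoc (step e′ w) e = step e′ (walk-snoc w e)

  walk-last-arc : ∀ {x z vs} → Walk E x z vs → x ≡ z ⊎ ∃[ y ] E y z
  walk-last-arc here = inj₁ refl
  walk-last-arc (step e w) with walk-last-arc w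
  ... | inj₁ refl = inj₂ (_ , e)
  ... | inj₂ arc  = inj₂ arc

  simple-suffix : ∀ {y z vs x} → Walk E y z vs → Unique vs → x ∈ vs →
                  ∃[ ws ] (Walk E x z ws × Unique ws × ws ⊆ vs)
  simple-suffix here       u       (here refl) = _ , here , u , λ k → k
  simple-suffix (step e w) u       (here refl) = _ , step e w , u , λ k → k
  simple-suffix (step e w) (_ ∷ u) (there x∈)  with simple-suffix w u x∈
  ... | ws , w′ , u′ , ws⊆ = ws , w′ , u′ , λ k → there (ws⊆ k)

  -- Every walk can be shortened to a simple walk with the same ends, using
  -- only its own vertices: a repeated first vertex is cut away by jumping
  -- to its later occurrence.
  simplify : ∀ {x z vs} → Walk E x z vs → ∃[ ws ] (Walk E x z ws × Unique ws × ws ⊆ vs)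
  simplify here = _ , here , ([] ∷ []) , λ k → k
  simplify {x = x} (step e w) with simplify w
  ... | ws , w′ , u′ , ws⊆ with any? (x ≟_) ws
  ...   | yes x∈ws with simple-suffix w′ u′ x∈ws
  ...     | us , w″ , u″ , us⊆ = us , w″ , u″ , λ k → there (ws⊆ (us⊆ k))
  simplify {x = x} (step e w) | ws , w′ , u′ , ws⊆ | no x∉ws =
    x ∷ ws , step e w′ , ¬Any⇒All¬ ws x∉ws ∷ u′ ,
    λ { (here refl) → here refl ; (there k) → there (ws⊆ k) }

open WalkFacts

module Ancestry {n : ℕ} (par : Fin n → Maybe (Fin n)) where

  anc-trans : ∀ {a b c} → Anc par a b → Anc par b c → Anc par a c
  anc-trans ab refl-anc    = ab
  anc-trans ab (up-anc e q) = up-anc e (anc-trans ab q)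

  anc-of-parentless : ∀ {a x} → par x ≡ nothing → Anc par a x → a ≡ x
  anc-of-parentless e refl-anc     = refl
  anc-of-parentless e (up-anc e′ _) = ⊥-elim (nothing≢just (trans (sym e) e′))

  -- If z is an ancestor of its own parent p, the chain of parents above any
  -- x below z runs around this cycle forever, so every ancestor r of x has
  -- a parent.  (Parents are unique, so the chains above x through r and
  -- through z coincide.)
  cycle-ancestor-has-parent : ∀ {z p r x} → par z ≡ just p → Anc par z p →
                              Anc par r x → Anc par z x → ∃[ q ] par r ≡ just q
  cycle-ancestor-has-parent {p = p} ez zp refl-anc refl-anc = p , ez
  cycle-ancestor-has-parent ez zp refl-anc (up-anc e _) = _ , e
  cycle-ancestor-has-parent ez zp (up-anc e rq) refl-anc with trans (sym ez) e
  ... | refl = cycle-ancestor-has-parent ez zp rq zp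
  cycle-ancestor-has-parent ez zp (up-anc e rq) (up-anc e′ zq) with trans (sym e) e′
  ... | refl = cycle-ancestor-has-parent ez zp rq zq

  not-anc-step : ∀ {y z q} → par y ≡ just q → y ≢ z → ¬ Anc par z q → ¬ Anc par z y
  not-anc-step e y≢z ¬zq refl-anc      = y≢z refl
  not-anc-step e y≢z ¬zq (up-anc e′ zq) with trans (sym e) e′
  ... | refl = ¬zq zq

module TreeFacts {n : ℕ} (T : RootedTree n) where
  open RootedTree T
  open Ancestry parent

  -- The parent relation of a rooted tree is acyclic: no vertex is an
  -- ancestor of its parent.  Otherwise the root, an ancestor of that parent,
  -- would lie on the cycle and have a parent.
  acyclic : ∀ {z p} → parent z ≡ just p → ¬ Anc parent z p
  acyclic {z} ez zp = z-not-outside z-not-in-tree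
    where
    z-not-outside : ¬ ¬ inT z
    z-not-outside ¬in = nothing≢just (trans (sym (par-out z ¬in)) ez)
    z≢root : z ≢ root
    z≢root refl = nothing≢just (trans (sym root-par) ez)
    z-not-in-tree : ¬ inT z
    z-not-in-tree in-z with par-in z in-z z≢root
    ... | _ , ez′ , in-p with trans (sym ez) ez′
    ... | refl with cycle-ancestor-has-parent ez zp (to-root _ in-p) zp
    ... | _ , root-has-parent = nothing≢just (trans (sym root-par) root-has-parent)

  -- If z and v' are siblings and v' is an ancestor of y, then y is not the
  -- parent of z (else v' would be an ancestor of its own parent y).
  sibling-above-not-parent : ∀ {y z v′ p} → parent z ≡ just p → parent v′ ≡ just p →
                             Anc parent v′ y → parent z ≢ just y
  sibling-above-not-parent ez ev′ v′y ezy with trans (sym ez) ezy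
  ... | refl = acyclic ev′ v′y

  -- By induction on the path from t(z)
  -- down to y: the source v' is t(z) = y itself, or the child of t(z) on the
  -- path to y.
  ancestor-or-derived : ∀ {y z p} → parent z ≡ just p → Anc parent p y →
                        Anc parent z y ⊎ ∃[ v′ ] (DerivedArcOf T y z v′ × Anc parent v′ y)
  ancestor-or-derived {y} ez refl-anc = inj₂ (y , (acyclic ez , inj₁ (ez , refl)) , refl-anc)
  ancestor-or-derived {y} {z} ez (up-anc {p = q} eyq qy) with ancestor-or-derived ez qy
  ... | inj₁ zq = inj₁ (up-anc eyq zq)
  ... | inj₂ (v′ , (¬zq , source) , _) with y ≟ z
  ...   | yes refl = inj₁ refl-anc
  ...   | no y≢z   = inj₂ (sibling-source source)
    where
    sibling : ∀ {v″ p′} → parent z ≡ just p′ → parent v″ ≡ just p′ → v″ ≢ z → Anc parent v″ y →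
              ∃[ v′ ] (DerivedArcOf T y z v′ × Anc parent v′ y)
    sibling ez′ ev″ v″≢z v″y =
      _ , (not-anc-step eyq y≢z ¬zq ,
           inj₂ (sibling-above-not-parent ez′ ev″ v″y , _ , ez′ , ev″ , v″≢z , v″y)) , v″y
    -- Either y is the child of t(z) = q on the path, or the source found
    -- for q is still a sibling of z above y.
    sibling-source : (parent z ≡ just q × v′ ≡ q)
                     ⊎ (parent z ≢ just q × ∃[ p′ ] (parent z ≡ just p′ × parent v′ ≡ just p′ × v′ ≢ z × Anc parent v′ q))
                     → ∃[ v′ ] (DerivedArcOf T y z v′ × Anc parent v′ y)
    sibling-source (inj₁ (ezq , _)) = sibling ezq eyq y≢z refl-anc
    sibling-source (inj₂ (_ , _ , ez′ , ev′ , v′≢z , v′q′)) = sibling ez′ ev′ v′≢z (up-anc eyq v′q′)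

module DerivedReachability {n : ℕ} (A : Arcs n) (s : Fin n) (flow : IsFlowGraph A s)
                           (T : RootedTree n) (pp : ParentProperty A T) where
  open RootedTree T
  open IsFlowGraph flow
  open Ancestry parent
  open TreeFacts T

  -- The start vertex is the root of T: the root is reachable from s, and
  -- an arc entering the root would give it a parent.
  root≡s : root ≡ s
  root≡s with walk-last-arc (proj₂ (reachable root))
  ... | inj₁ s≡root = sym s≡root
  ... | inj₂ (y , arc) with pp y root arc
  ... | _ , root-has-parent , _ = ⊥-elim (nothing≢just (trans (sym root-par) root-has-parent))

  _↝_ : Fin n → List (Fin n) → Set
  a ↝ M = ∃[ Q ] (Walk (DerivedArc A T) s a Q × All (_∈ M) Q)

  AncestorsReach : List (Fin n) → Fin n → Set
  AncestorsReach M y = ∀ {a} → Anc parent a y → a ↝ M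

  -- At the start: s is the root, hence its own only ancestor.
  ancestors-reach-start : ∀ {M} → s ∈ M → AncestorsReach M s
  ancestors-reach-start s∈M a-anc with anc-of-parentless (subst (λ r → parent r ≡ nothing) root≡s root-par) a-anc
  ... | refl = _ , here , (s∈M ∷ [])

  -- Across one arc (y , z) of G with z ∈ M.  A proper ancestor of z is an
  -- ancestor of t(z), hence of y by the parent property; z itself is handled
  -- by the dichotomy of ancestor-or-derived.
  ancestors-reach-step : ∀ {M y z} → AncestorsReach M y → (y , z) ∈ A → z ∈ M → AncestorsReach M z
  ancestors-reach-step {M} {y} {z} reach-y arc z∈M with pp y z arc
  ... | _ , ez , py = reach-z
    where
    z-reaches : z ↝ M
    z-reaches with ancestor-or-derived ez py
    ... | inj₁ zy = reach-y zy
    ... | inj₂ (v′ , derived , v′y) with reach-y v′y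
    ... | Q , walk , Q⊆M = Q ++ (z ∷ []) , walk-snoc walk (y , arc , derived) , ++⁺ Q⊆M (z∈M ∷ [])

    reach-z : AncestorsReach M z
    reach-z refl-anc = z-reaches
    reach-z (up-anc ez′ a-p) with trans (sym ez) ez′
    ... | refl = reach-y (anc-trans a-p py)

  ancestors-reach-walk : ∀ {M y z vs} → AncestorsReach M y → Walk (Arc A) y z vs → All (_∈ M) vs →
                         AncestorsReach M z
  ancestors-reach-walk reach-y here             _          = reach-y
  ancestors-reach-walk reach-y (step arc walk) (_ ∷ vs⊆M) =
    ancestors-reach-walk (ancestors-reach-step reach-y arc (All.lookup vs⊆M (walk-head∈ walk))) walk vs⊆M

  derived-simple-walk : ∀ {v P} → Walk (Arc A) s v P →
                        ∃[ Q ] (Walk (DerivedArc A T) s v Q × Unique Q × All (_∈ P) Q)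
  derived-simple-walk walk
    with ancestors-reach-walk (ancestors-reach-start (walk-head∈ walk)) walk (All.tabulate (λ x∈P → x∈P)) refl-anc
  ... | Q , walk′ , Q⊆P with simplify walk′
  ... | Q′ , walk″ , unique , Q′⊆Q = Q′ , walk″ , unique , All.tabulate (λ x∈Q′ → All.lookup Q⊆P (Q′⊆Q x∈Q′))

-- Lemma 12: a simple path P of G from s to v yields a simple path of the
-- derived graph G' from s to v using only vertices of P.
lemma12 : {n : ℕ} (A : Arcs n) (s : Fin n) → IsFlowGraph A s →
          (T : RootedTree n) → ParentProperty A T →
          (v : Fin n) (P : List (Fin n)) → Walk (Arc A) s v P → Unique P →
          ∃[ Q ] (Walk (DerivedArc A T) s v Q × Unique Q × All (λ x → x ∈ P) Q)
lemma12 A s flow T pp v P walk _ = DerivedReachability.derived-simple-walk A s flow T pp walk
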